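{- Let $(c_k)_{k\ge0}$ be the integer sequence with $c_{2k}=(-1)^kC_k$ and $c_{2k+1}=0$ for all $k\ge0$, where $C_k=\frac{1}{k+1}\binom{2k}{k}$ is the $k$-th Catalan number. Let $H_1=(c_{i+j})_{i,j\ge0}$ and $H_2=(c_{i+j}\bmod 2)_{i,j\ge0}$, both regarded as matrices over $\mathbb Z$ (with $c_{i+j}\bmod 2\in\{0,1\}$). Then for every $n\in\mathbb N$, the upper left $n\times n$ submatrices $H_1^{(n)}=(c_{i+j})_{0\le i,j<n}$ and $H_2^{(n)}=(c_{i+j}\bmod 2)_{0\le i,j<n}$ satisfy $\det(H_1^{(n)})=\pm1$ and $\det(H_2^{(n)})=\pm1$. -}

module Defs where

open import Data.Nat as ℕ using (ℕ; zero; suc)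
open import Data.Nat.Combinatorics using (_C_)
open import Data.Integer as ℤ using (ℤ; +_; -_; _+_; _*_; _%_)
open import Data.Fin using (Fin; zero; suc; toℕ)
open import Data.Fin.Base using (punchIn)

-- k-th Catalan number C_k = binom(2k,k)/(k+1) (exact division)
catalan : ℕ → ℕ
catalan k = ((2 ℕ.* k) C k) ℕ./ suc k

sign : ℕ → ℤ
sign zero = + 1
sign (suc k) = - sign k

c : ℕ → ℤ
c n with n ℕ.% 2
... | zero  = sign (n ℕ./ 2) * + catalan (n ℕ./ 2)
... | suc _ = + 0

Matrix : ℕ → Set
Matrix n = Fin n → Fin n → ℤ

∑ : ∀ {m} → (Fin m → ℤ) → ℤ
∑ {zero} f = + 0
∑ {suc m} f = f zero + ∑ (λ j → f (suc j))

det : ∀ {n} → Matrix n → ℤ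
det {zero} A = + 1
det {suc n} A =
  ∑ (λ j → sign (toℕ j) * A zero j * det (λ r s → A (suc r) (punchIn j s)))

H₁ : ∀ n → Matrix n
H₁ n i j = c (toℕ i ℕ.+ toℕ j)

H₂ : ∀ n → Matrix n
H₂ n i j = + (c (toℕ i ℕ.+ toℕ j) % + 2)

{-# OPTIONS --safe #-}
-- H₁: let L be the functional xⁿ ↦ c n and F_k the Fibonacci polynomials (F₁ = 1, F₂ = x,
-- F_{k+2} = x F_{k+1} + F_k). Then L(x^j F_{k+1}) = ±ballot j k, the number of nonnegative
-- ±1-paths of length j from height k to 0; in particular C_m = ballot 2m 0, ballot j k = 0 for
-- j < k and ballot k k = 1. So multiplying H₁ by the unit lower triangular matrix of the
-- coefficients of F_{k+1} gives an upper triangular matrix with diagonal ±1.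
--
-- H₂: its entries are the aeration of e m = C_m mod 2 (e m at index 2m, 0 at odd indices), and
-- the Catalan recurrence gives e 0 = 1, e (2m+1) = e m, e (2m+2) = 0. Ordering rows and columns
-- of such Hankel matrices by the parity of the index makes them block triangular; this expresses
-- the Hankel determinants of order n of e and of its aeration as ± products of those of order
-- about n/2, and induction on n finishes.
module Submission where

open import Defs
open import Data.Nat using (ℕ)
open import Data.Integer using (+_; -_)
open import Data.Sum using (_⊎_)
open import Data.Product using (_×_)
open import Relation.Binary.PropositionalEquality using (_≡_)

open import Data.Empty using (⊥-elim)
open import Data.Fin as F using (Fin; zero; suc; toℕ; punchIn; punchOut; _↑ˡ_; _↑ʳ_)
import Data.Fin.Properties as FP
open import Data.Integer as ℤ using (ℤ; _+_; _*_)
import Data.Integer.Properties as ℤP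
open import Data.Integer.Tactic.RingSolver using (solve-∀)
open import Data.Nat as ℕ using (zero; suc; _∸_)
open import Data.Nat.Combinatorics using (_C_; nCk≡nC[n∸k]; nC1≡n)
  renaming (nCk+nC[k+1]≡[n+1]C[k+1] to pascal)
import Data.Nat.DivMod as ND
open import Data.Nat.Induction using (<-rec)
import Data.Nat.Properties as ℕP
import Data.Nat.Tactic.RingSolver as ℕS
open import Data.Product using (∃; ∃-syntax; _,_; proj₂)
open import Data.Sum using (inj₁; inj₂; [_,_])
open import Data.Vec.Functional using (_∷_; removeAt)
open import Function using (_∘_; flip)
open import Function.Definitions using (Injective)
open import Relation.Binary.PropositionalEquality
  using (_≢_; refl; sym; trans; cong; cong₂; subst; module ≡-Reasoning)
open import Relation.Nullary using (yes; no)

open import Algebra.Properties.Semiring.Sum ℤP.+-*-semiring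
  using (sum; sum-cong-≗; sum-replicate-zero; ∑-distrib-+; ∑-comm; *-distribˡ-sum; sum-remove)

∑≡sum : ∀ {m} (f : Fin m → ℤ) → ∑ f ≡ sum f
∑≡sum {zero} f = refl
∑≡sum {suc m} f = cong (_+_ (f zero)) (∑≡sum (f ∘ suc))

∑-cong : ∀ {m} {f g : Fin m → ℤ} → (∀ i → f i ≡ g i) → ∑ f ≡ ∑ g
∑-cong {f = f} {g} f≗g = trans (∑≡sum f) (trans (sum-cong-≗ f≗g) (sym (∑≡sum g)))

∑-zero : ∀ {m} (f : Fin m → ℤ) → (∀ i → f i ≡ + 0) → ∑ f ≡ + 0
∑-zero {m} f f≗0 = trans (∑≡sum f) (trans (sum-cong-≗ f≗0) (sum-replicate-zero m))

∑-+ : ∀ {m} (f g : Fin m → ℤ) → ∑ (λ i → f i + g i) ≡ ∑ f + ∑ g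
∑-+ f g = begin
  ∑ (λ i → f i + g i)    ≡⟨ ∑≡sum (λ i → f i + g i) ⟩
  sum (λ i → f i + g i)  ≡⟨ ∑-distrib-+ f g ⟩
  sum f + sum g          ≡⟨ cong₂ _+_ (∑≡sum f) (∑≡sum g) ⟨
  ∑ f + ∑ g              ∎
  where open ≡-Reasoning

*-distribˡ-∑ : ∀ {m} x (f : Fin m → ℤ) → x * ∑ f ≡ ∑ (λ i → x * f i)
*-distribˡ-∑ x f = begin
  x * ∑ f              ≡⟨ cong (x *_) (∑≡sum f) ⟩
  x * sum f            ≡⟨ *-distribˡ-sum x f ⟩
  sum (λ i → x * f i)  ≡⟨ ∑≡sum (λ i → x * f i) ⟨
  ∑ (λ i → x * f i)    ∎
  where open ≡-Reasoning

∑∑≡sum-sum : ∀ {m k} (f : Fin m → Fin k → ℤ) → ∑ (λ i → ∑ (f i)) ≡ sum (λ i → sum (f i))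
∑∑≡sum-sum f = trans (∑≡sum (λ i → ∑ (f i))) (sum-cong-≗ (∑≡sum ∘ f))

∑-swap : ∀ {m k} (f : Fin m → Fin k → ℤ) → ∑ (λ i → ∑ (f i)) ≡ ∑ (λ j → ∑ (λ i → f i j))
∑-swap f = trans (∑∑≡sum-sum f) (trans (∑-comm f) (sym (∑∑≡sum-sum (flip f))))

∑-remove : ∀ {m} (f : Fin (suc m) → ℤ) i → ∑ f ≡ f i + ∑ (removeAt f i)
∑-remove f i =
  trans (∑≡sum f) (trans (sum-remove f) (cong (_+_ (f i)) (sym (∑≡sum (removeAt f i)))))

∑-neg : ∀ {m} (f : Fin m → ℤ) → ∑ (λ i → - f i) ≡ - ∑ f
∑-neg f = begin
  ∑ (λ i → - f i)        ≡⟨ ∑-cong (λ i → sym (ℤP.-1*i≡-i (f i))) ⟩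
  ∑ (λ i → - + 1 * f i)  ≡⟨ *-distribˡ-∑ (- + 1) f ⟨
  - + 1 * ∑ f            ≡⟨ ℤP.-1*i≡-i (∑ f) ⟩
  - ∑ f                  ∎
  where open ≡-Reasoning

∑-splitAt : ∀ p {q} (f : Fin (p ℕ.+ q) → ℤ) →
            ∑ f ≡ ∑ (λ i → f (i ↑ˡ q)) + ∑ (λ j → f (p ↑ʳ j))
∑-splitAt zero f = sym (ℤP.+-identityˡ (∑ f))
∑-splitAt (suc p) f =
  trans (cong (_+_ (f zero)) (∑-splitAt p (f ∘ suc))) (sym (ℤP.+-assoc (f zero) _ _))

IsUnit : ℤ → Set
IsUnit x = x ≡ + 1 ⊎ x ≡ - + 1

sign-isUnit : ∀ k → IsUnit (sign k)
sign-isUnit zero = inj₁ refl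
sign-isUnit (suc k) with sign-isUnit k
... | inj₁ sk≡1 = inj₂ (cong -_ sk≡1)
... | inj₂ sk≡-1 = inj₁ (cong -_ sk≡-1)

isUnit-* : ∀ {x y} → IsUnit x → IsUnit y → IsUnit (x * y)
isUnit-* (inj₁ refl) (inj₁ refl) = inj₁ refl
isUnit-* (inj₁ refl) (inj₂ refl) = inj₂ refl
isUnit-* (inj₂ refl) (inj₁ refl) = inj₂ refl
isUnit-* (inj₂ refl) (inj₂ refl) = inj₁ refl

isUnit-*-cancelˡ : ∀ {u} → IsUnit u → ∀ {x y} → u * x ≡ u * y → x ≡ y
isUnit-*-cancelˡ (inj₁ refl) {x} {y} eq =
  trans (sym (ℤP.*-identityˡ x)) (trans eq (ℤP.*-identityˡ y))
isUnit-*-cancelˡ (inj₂ refl) {x} {y} eq =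
  ℤP.neg-injective (trans (sym (ℤP.-1*i≡-i x)) (trans eq (ℤP.-1*i≡-i y)))

isUnit-flip : ∀ {u} → IsUnit u → ∀ {x y} → x ≡ u * y → y ≡ u * x
isUnit-flip (inj₁ refl) {y = y} refl = sym (trans (ℤP.*-identityˡ _) (ℤP.*-identityˡ y))
isUnit-flip (inj₂ refl) {y = y} refl =
  sym (trans (ℤP.-1*i≡-i _) (trans (cong -_ (ℤP.-1*i≡-i y)) (ℤP.neg-involutive y)))

infix 4 _≡±_

_≡±_ : ℤ → ℤ → Set
x ≡± y = ∃[ ε ] IsUnit ε × x ≡ ε * y

≡±-respʳ : ∀ {x y y′} → x ≡± y → y ≡ y′ → x ≡± y′
≡±-respʳ (ε , ε-unit , x≡εy) y≡y′ = ε , ε-unit , trans x≡εy (cong (ε *_) y≡y′)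

isUnit-≡±-* : ∀ {x y z} → x ≡± y * z → IsUnit y → IsUnit z → IsUnit x
isUnit-≡±-* (ε , ε-unit , x≡εyz) y-unit z-unit =
  subst IsUnit (sym x≡εyz) (isUnit-* ε-unit (isUnit-* y-unit z-unit))

i≡-i⇒i≡0 : ∀ {i} → i ≡ - i → i ≡ + 0
i≡-i⇒i≡0 {+ zero} _ = refl
i≡-i⇒i≡0 {+ suc n} ()
i≡-i⇒i≡0 {ℤ.-[1+ n ]} ()

sgn : ∀ {n} → Fin n → ℤ
sgn j = sign (toℕ j)

minor : ∀ {n} → Matrix (suc n) → Fin (suc n) → Matrix n
minor A j r c = A (suc r) (punchIn j c)

laplaceTerm : ∀ {n} → Matrix (suc n) → Fin (suc n) → ℤ
laplaceTerm A j = sgn j * A zero j * det (minor A j)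

det-cong : ∀ {n} {A B : Matrix n} → (∀ i j → A i j ≡ B i j) → det A ≡ det B
det-cong {zero} A≗B = refl
det-cong {suc n} A≗B = ∑-cong λ j →
  cong₂ (λ a d → sgn j * a * d) (A≗B zero j) (det-cong (λ r c → A≗B (suc r) (punchIn j c)))

_ᵀ : ∀ {n} → Matrix n → Matrix n
(A ᵀ) i j = A j i

swapAdjacent : ∀ {n} → Fin n → Fin (suc n) → Fin (suc n)
swapAdjacent zero zero = suc zero
swapAdjacent zero (suc zero) = zero
swapAdjacent zero (suc (suc k)) = suc (suc k)
swapAdjacent (suc r) zero = zero
swapAdjacent (suc r) (suc k) = suc (swapAdjacent r k)

∑-swapAdjacent : ∀ {n} (r : Fin n) (f : Fin (suc n) → ℤ) → ∑ f ≡ ∑ (f ∘ swapAdjacent r)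
∑-swapAdjacent zero f = swap-front (f zero) (f (suc zero)) (∑ (λ k → f (suc (suc k))))
  where
  swap-front : ∀ a b c → a + (b + c) ≡ b + (a + c)
  swap-front = solve-∀
∑-swapAdjacent (suc r) f = cong (_+_ (f zero)) (∑-swapAdjacent r (f ∘ suc))

-- Deleting column j after swapping columns r, r + 1: either j is one of the two (the deleted
-- column changes and its sign flips), or j is fixed and the swap descends to the minor.
data SwapCase {m} (r : Fin (suc m)) (j : Fin (suc (suc m))) : Set where
  moved : (∀ k → swapAdjacent r (punchIn j k) ≡ punchIn (swapAdjacent r j) k) →
          sgn j ≡ - sgn (swapAdjacent r j) → SwapCase r j
  fixed : (r′ : Fin m) → swapAdjacent r j ≡ j →
          (∀ k → swapAdjacent r (punchIn j k) ≡ punchIn j (swapAdjacent r′ k)) → SwapCase r j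

swapCase : ∀ {m} (r : Fin (suc m)) (j : Fin (suc (suc m))) → SwapCase r j
swapCase zero zero = moved (λ { zero → refl ; (suc k) → refl }) refl
swapCase zero (suc zero) = moved (λ { zero → refl ; (suc k) → refl }) refl
swapCase {zero} zero (suc (suc ()))
swapCase {suc m} zero (suc (suc j)) =
  fixed zero refl (λ { zero → refl ; (suc zero) → refl ; (suc (suc k)) → refl })
swapCase (suc r) zero = fixed r refl (λ k → refl)
swapCase {suc m} (suc r) (suc j) with swapCase r j
... | moved comm sgn-flip =
  moved (λ { zero → refl ; (suc k) → cong suc (comm k) }) (cong -_ sgn-flip)
... | fixed r′ fix comm =
  fixed (suc r′) (cong suc fix) (λ { zero → refl ; (suc k) → cong suc (comm k) })

det-swapAdjacentColumns : ∀ {n} (A : Matrix (suc n)) (r : Fin n) →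
                          det (λ i j → A i (swapAdjacent r j)) ≡ - det A
det-swapAdjacentColumns {suc m} A r = begin
  ∑ (λ j → sgn j * A zero (swapAdjacent r j) * det (swappedMinor j))
    ≡⟨ ∑-cong swapped-term ⟩
  ∑ (λ j → - laplaceTerm A (swapAdjacent r j))  ≡⟨ ∑-neg (laplaceTerm A ∘ swapAdjacent r) ⟩
  - ∑ (laplaceTerm A ∘ swapAdjacent r)          ≡⟨ cong -_ (∑-swapAdjacent r (laplaceTerm A)) ⟨
  - det A                                       ∎
  where
  open ≡-Reasoning
  swappedMinor : Fin (suc (suc m)) → Matrix (suc m)
  swappedMinor j a b = A (suc a) (swapAdjacent r (punchIn j b))
  swapped-term : ∀ j → sgn j * A zero (swapAdjacent r j) * det (swappedMinor j)
                       ≡ - laplaceTerm A (swapAdjacent r j)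
  swapped-term j with swapCase r j
  ... | moved comm sgn-flip = begin
    sgn j * A zero j′ * det (swappedMinor j)
      ≡⟨ cong₂ (λ s d → s * A zero j′ * d) sgn-flip (det-cong (λ a b → cong (A (suc a)) (comm b))) ⟩
    - sgn j′ * A zero j′ * det (minor A j′)  ≡⟨ neg-out (sgn j′) _ _ ⟩
    - laplaceTerm A j′                       ∎
    where
    j′ = swapAdjacent r j
    neg-out : ∀ a b c → - a * b * c ≡ - (a * b * c)
    neg-out = solve-∀
  ... | fixed r′ fix comm = begin
    sgn j * A zero (swapAdjacent r j) * det (swappedMinor j)
      ≡⟨ cong₂ (λ k d → sgn j * A zero k * d) fix
           (trans (det-cong (λ a b → cong (A (suc a)) (comm b))) (det-swapAdjacentColumns (minor A j) r′)) ⟩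
    sgn j * A zero j * - det (minor A j)  ≡⟨ neg-out (sgn j) _ _ ⟩
    - laplaceTerm A j                     ≡⟨ cong (-_ ∘ laplaceTerm A) fix ⟨
    - laplaceTerm A (swapAdjacent r j)    ∎
    where
    neg-out : ∀ a b c → a * b * - c ≡ - (a * b * c)
    neg-out = solve-∀

det-expandFirstColumn : ∀ {n} (A : Matrix (suc n)) →
                        det A ≡ ∑ (λ i → sgn i * A i zero * det (λ a b → A (punchIn i a) (suc b)))
det-expandFirstColumn {zero} A = refl
det-expandFirstColumn {suc n} A = cong (_+_ (laplaceTerm A zero)) (begin
  ∑ (λ j → - sgn j * A zero (suc j) * det (minor A (suc j)))
    ≡⟨ ∑-cong (λ j → cong (- sgn j * A zero (suc j) *_) (det-expandFirstColumn (minor A (suc j)))) ⟩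
  ∑ (λ j → - sgn j * A zero (suc j) * ∑ (λ i → sgn i * A (suc i) zero * D i j))
    ≡⟨ ∑-cong (λ j → *-distribˡ-∑ (- sgn j * A zero (suc j)) (λ i → sgn i * A (suc i) zero * D i j)) ⟩
  ∑ (λ j → ∑ (λ i → T j i))
    ≡⟨ ∑-swap T ⟩
  ∑ (λ i → ∑ (λ j → T j i))
    ≡⟨ ∑-cong (λ i → ∑-cong (λ j → exchange (sgn j) (A zero (suc j)) (sgn i) (A (suc i) zero) (D i j))) ⟩
  ∑ (λ i → ∑ (λ j → (- sgn i * A (suc i) zero) * (sgn j * A zero (suc j) * D i j)))
    ≡⟨ ∑-cong (λ i → *-distribˡ-∑ (- sgn i * A (suc i) zero) (λ j → sgn j * A zero (suc j) * D i j)) ⟨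
  ∑ (λ i → - sgn i * A (suc i) zero * ∑ (λ j → sgn j * A zero (suc j) * D i j)) ∎)
  where
  open ≡-Reasoning
  D : Fin (suc n) → Fin (suc n) → ℤ
  D i j = det (λ a b → A (suc (punchIn i a)) (suc (punchIn j b)))
  T : Fin (suc n) → Fin (suc n) → ℤ
  T j i = (- sgn j * A zero (suc j)) * (sgn i * A (suc i) zero * D i j)
  exchange : ∀ a b c d e → (- a * b) * (c * d * e) ≡ (- c * d) * (a * b * e)
  exchange = solve-∀

det-ᵀ : ∀ {n} (A : Matrix n) → det (A ᵀ) ≡ det A
det-ᵀ {zero} A = refl
det-ᵀ {suc n} A = trans
  (∑-cong (λ i → cong (sgn i * A i zero *_) (det-ᵀ (λ a b → A (punchIn i a) (suc b)))))
  (sym (det-expandFirstColumn A))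

det-swapAdjacentRows : ∀ {n} (A : Matrix (suc n)) (r : Fin n) → det (A ∘ swapAdjacent r) ≡ - det A
det-swapAdjacentRows A r = begin
  det (A ∘ swapAdjacent r)                  ≡⟨ det-ᵀ (A ∘ swapAdjacent r) ⟨
  det (λ i j → (A ᵀ) i (swapAdjacent r j))  ≡⟨ det-swapAdjacentColumns (A ᵀ) r ⟩
  - det (A ᵀ)                               ≡⟨ cong -_ (det-ᵀ A) ⟩
  - det A                                   ∎
  where open ≡-Reasoning

ScalesDet : ∀ {n} → (Fin n → Fin n) → ℤ → Set
ScalesDet {n} σ ε = ∀ (A : Matrix n) → det (A ∘ σ) ≡ ε * det A

scalesDet-lift : ∀ {n} {σ : Fin n → Fin n} {ε} → ScalesDet σ ε → ScalesDet (F.lift 1 σ) ε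
scalesDet-lift {σ = σ} {ε} scales A = begin
  ∑ (λ j → sgn j * A zero j * det (minor A j ∘ σ))
    ≡⟨ ∑-cong (λ j → cong (sgn j * A zero j *_) (scales (minor A j))) ⟩
  ∑ (λ j → sgn j * A zero j * (ε * det (minor A j)))
    ≡⟨ ∑-cong (λ j → pull-out (sgn j) (A zero j) ε (det (minor A j))) ⟩
  ∑ (λ j → ε * laplaceTerm A j)
    ≡⟨ *-distribˡ-∑ ε (laplaceTerm A) ⟨
  ε * det A ∎
  where
  open ≡-Reasoning
  pull-out : ∀ a b c d → a * b * (c * d) ≡ c * (a * b * d)
  pull-out = solve-∀

scalesDet-rotate : ∀ {n} (i : Fin (suc n)) → ScalesDet (i ∷ punchIn i) (sgn i)
scalesDet-rotate zero A = sym (ℤP.*-identityˡ (det A))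
scalesDet-rotate {suc n} (suc i) A = begin
  det (A ∘ (suc i ∷ punchIn (suc i)))  ≡⟨ det-cong rows ⟩
  det (B ∘ swapAdjacent zero)          ≡⟨ det-swapAdjacentRows B zero ⟩
  - det B                              ≡⟨ cong -_ (scalesDet-lift {σ = i ∷ punchIn i} {sgn i}
                                                                 (scalesDet-rotate i) A) ⟩
  - (sgn i * det A)                    ≡⟨ ℤP.neg-distribˡ-* (sgn i) (det A) ⟩
  sgn (suc i) * det A                  ∎
  where
  open ≡-Reasoning
  B = A ∘ F.lift 1 (i ∷ punchIn i)
  rows : ∀ r c → A ((suc i ∷ punchIn (suc i)) r) c ≡ B (swapAdjacent zero r) c
  rows zero c = refl
  rows (suc zero) c = refl
  rows (suc (suc r)) c = refl

zero-preimage : ∀ {m} {σ : Fin (suc m) → Fin (suc m)} → Injective _≡_ _≡_ σ → ∃ λ i → σ i ≡ zero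
zero-preimage {m} {σ} σ-inj with FP.any? (λ i → σ i F.≟ zero)
... | yes hit = hit
... | no miss = ⊥-elim (ℕP.1+n≰n (FP.injective⇒≤ {f = σ′} σ′-inj))
  where
  0≢σ : ∀ i → zero ≢ σ i
  0≢σ i 0≡σi = miss (i , sym 0≡σi)
  σ′ : Fin (suc m) → Fin m
  σ′ i = punchOut (0≢σ i)
  σ′-inj : Injective _≡_ _≡_ σ′
  σ′-inj {i} {j} = σ-inj ∘ FP.punchOut-injective (0≢σ i) (0≢σ j)

module _ {m} {σ : Fin (suc m) → Fin (suc m)} (σ-inj : Injective _≡_ _≡_ σ) {i} (σi≡0 : σ i ≡ zero) where

  private
    0≢σ[i+r] : ∀ r → zero ≢ σ (punchIn i r)
    0≢σ[i+r] r 0≡σ[i+r] = FP.punchInᵢ≢i i r (σ-inj (trans (sym 0≡σ[i+r]) (sym σi≡0)))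

  dropZero : Fin m → Fin m
  dropZero r = punchOut (0≢σ[i+r] r)

  dropZero-injective : Injective _≡_ _≡_ dropZero
  dropZero-injective {r} {r′} =
    FP.punchIn-injective i r r′ ∘ σ-inj ∘ FP.punchOut-injective (0≢σ[i+r] r) (0≢σ[i+r] r′)

  scalesDet-dropZero : ∀ {ε} → ScalesDet dropZero ε → ScalesDet σ (sgn i * ε)
  scalesDet-dropZero {ε} scales A = trans (isUnit-flip (sign-isUnit (toℕ i)) (begin
    ε * det A                      ≡⟨ scalesDet-lift {σ = dropZero} {ε} scales A ⟨
    det (A ∘ F.lift 1 dropZero)    ≡⟨ det-cong rows ⟨
    det (A ∘ σ ∘ (i ∷ punchIn i))  ≡⟨ scalesDet-rotate i (A ∘ σ) ⟩
    sgn i * det (A ∘ σ)            ∎)) (sym (ℤP.*-assoc (sgn i) ε (det A)))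
    where
    open ≡-Reasoning
    rows : ∀ r c → A (σ ((i ∷ punchIn i) r)) c ≡ A (F.lift 1 dropZero r) c
    rows zero c = cong (λ k → A k c) σi≡0
    rows (suc r) c = cong (λ k → A k c) (sym (FP.punchIn-punchOut (0≢σ[i+r] r)))

injective⇒scalesDet : ∀ {n} {σ : Fin n → Fin n} → Injective _≡_ _≡_ σ →
                      ∃[ ε ] IsUnit ε × ScalesDet σ ε
injective⇒scalesDet {zero} σ-inj = + 1 , inj₁ refl , λ A → refl
injective⇒scalesDet {suc m} σ-inj with zero-preimage σ-inj
... | i , σi≡0 with injective⇒scalesDet (dropZero-injective σ-inj σi≡0)
...   | ε , ε-unit , scales =
        sgn i * ε , isUnit-* (sign-isUnit (toℕ i)) ε-unit , scalesDet-dropZero σ-inj σi≡0 scales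

det-topTwoEqual : ∀ {n} (x : Fin (suc (suc n)) → ℤ) (R : Fin n → Fin (suc (suc n)) → ℤ) →
                  det (x ∷ x ∷ R) ≡ + 0
det-topTwoEqual x R = i≡-i⇒i≡0 (trans (det-cong rows) (det-swapAdjacentRows (x ∷ x ∷ R) zero))
  where
  rows : ∀ r c → (x ∷ x ∷ R) r c ≡ (x ∷ x ∷ R) (swapAdjacent zero r) c
  rows zero c = refl
  rows (suc zero) c = refl
  rows (suc (suc r)) c = refl

det-repeatedTop : ∀ {n} (R : Fin n → Fin (suc n) → ℤ) k → det (R k ∷ R) ≡ + 0
det-repeatedTop {suc n} R k = isUnit-*-cancelˡ (sign-isUnit (toℕ k)) (begin
  sgn k * det (R k ∷ R)
    ≡⟨ scalesDet-lift {σ = k ∷ punchIn k} {sgn k} (scalesDet-rotate k) (R k ∷ R) ⟨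
  det ((R k ∷ R) ∘ F.lift 1 (k ∷ punchIn k))  ≡⟨ det-cong rows ⟩
  det (R k ∷ R k ∷ removeAt R k)              ≡⟨ det-topTwoEqual (R k) (removeAt R k) ⟩
  + 0                                         ≡⟨ ℤP.*-zeroʳ (sgn k) ⟨
  sgn k * + 0                                 ∎)
  where
  open ≡-Reasoning
  rows : ∀ r c → (R k ∷ R) (F.lift 1 (k ∷ punchIn k) r) c ≡ (R k ∷ R k ∷ removeAt R k) r c
  rows zero c = refl
  rows (suc zero) c = refl
  rows (suc (suc r)) c = refl

det-linearTop : ∀ {m n} (t : Fin m → ℤ) (u : Fin m → Fin (suc n) → ℤ) (R : Fin n → Fin (suc n) → ℤ) →
                det ((λ j → ∑ (λ i → t i * u i j)) ∷ R) ≡ ∑ (λ i → t i * det (u i ∷ R))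
det-linearTop t u R = begin
  ∑ (λ j → sgn j * ∑ (λ i → t i * u i j) * D j)
    ≡⟨ ∑-cong (λ j → move (sgn j) (∑ (λ i → t i * u i j)) (D j)) ⟩
  ∑ (λ j → (sgn j * D j) * ∑ (λ i → t i * u i j))
    ≡⟨ ∑-cong (λ j → *-distribˡ-∑ (sgn j * D j) (λ i → t i * u i j)) ⟩
  ∑ (λ j → ∑ (λ i → (sgn j * D j) * (t i * u i j)))
    ≡⟨ ∑-swap (λ j i → (sgn j * D j) * (t i * u i j)) ⟩
  ∑ (λ i → ∑ (λ j → (sgn j * D j) * (t i * u i j)))
    ≡⟨ ∑-cong (λ i → ∑-cong (λ j → regroup (sgn j) (D j) (t i) (u i j))) ⟩
  ∑ (λ i → ∑ (λ j → t i * (sgn j * u i j * D j)))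
    ≡⟨ ∑-cong (λ i → *-distribˡ-∑ (t i) (λ j → sgn j * u i j * D j)) ⟨
  ∑ (λ i → t i * det (u i ∷ R)) ∎
  where
  open ≡-Reasoning
  D : Fin (suc _) → ℤ
  D j = det (λ r c → R r (punchIn j c))
  move : ∀ a b c → a * b * c ≡ (a * c) * b
  move = solve-∀
  regroup : ∀ a b c d → (a * b) * (c * d) ≡ c * (a * d * b)
  regroup = solve-∀

infixl 7 _*ᴹ_

_*ᴹ_ : ∀ {n} → Matrix n → Matrix n → Matrix n
(L *ᴹ A) k j = ∑ (λ i → L k i * A i j)

punchIn-mono-< : ∀ {n} (ℓ : Fin (suc n)) {r i : Fin n} → r F.< i → punchIn ℓ r F.< punchIn ℓ i
punchIn-mono-< ℓ {r} {i} r<i = ℕP.≰⇒> (λ i≤r → ℕP.<⇒≱ r<i (FP.punchIn-cancel-≤ ℓ i r i≤r))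

punchIn-last-< : ∀ {n} (r : Fin n) → punchIn (F.fromℕ n) r F.< F.fromℕ n
punchIn-last-< {n} r =
  ℕP.≤∧≢⇒< (FP.≤fromℕ (punchIn (F.fromℕ n) r)) (FP.punchInᵢ≢i (F.fromℕ n) r ∘ FP.toℕ-injective)

-- After moving the last row to the top, the other rows of L *ᴹ A only combine the other rows of A
-- (induction on the minors), and the top row is handled by linearity and det-repeatedTop.
det-unitLowerTriangular-*ᴹ : ∀ {n} (L A : Matrix n) → (∀ k i → k F.< i → L k i ≡ + 0) →
                             (∀ k → L k k ≡ + 1) → det (L *ᴹ A) ≡ det A
det-unitLowerTriangular-*ᴹ {zero} L A _ _ = refl
det-unitLowerTriangular-*ᴹ {suc m} L A above≡0 diag = isUnit-*-cancelˡ (sign-isUnit (toℕ ℓ)) (begin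
  sgn ℓ * det (L *ᴹ A)                    ≡⟨ scalesDet-rotate ℓ (L *ᴹ A) ⟨
  det ((L *ᴹ A) ℓ ∷ removeAt (L *ᴹ A) ℓ)
    ≡⟨ ∑-cong (λ j → cong (sgn j * (L *ᴹ A) ℓ j *_) (lower-rows j)) ⟩
  det ((L *ᴹ A) ℓ ∷ A′)                   ≡⟨ det-linearTop (L ℓ) A A′ ⟩
  ∑ (λ i → L ℓ i * det (A i ∷ A′))        ≡⟨ ∑-remove (λ i → L ℓ i * det (A i ∷ A′)) ℓ ⟩
  L ℓ ℓ * det (A ℓ ∷ A′) + ∑ (λ i → L ℓ (punchIn ℓ i) * det (A′ i ∷ A′))
    ≡⟨ cong₂ _+_ (cong (_* det (A ℓ ∷ A′)) (diag ℓ)) (∑-zero _ repeated) ⟩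
  + 1 * det (A ℓ ∷ A′) + + 0              ≡⟨ trans (ℤP.+-identityʳ _) (ℤP.*-identityˡ _) ⟩
  det (A ℓ ∷ A′)                          ≡⟨ scalesDet-rotate ℓ A ⟩
  sgn ℓ * det A                           ∎)
  where
  open ≡-Reasoning
  ℓ = F.fromℕ m
  A′ = removeAt A ℓ
  L′ : Matrix m
  L′ r i = L (punchIn ℓ r) (punchIn ℓ i)
  repeated : ∀ i → L ℓ (punchIn ℓ i) * det (A′ i ∷ A′) ≡ + 0
  repeated i = trans (cong (L ℓ (punchIn ℓ i) *_) (det-repeatedTop A′ i)) (ℤP.*-zeroʳ (L ℓ (punchIn ℓ i)))
  lower-rows : ∀ j → det (λ r c → (L *ᴹ A) (punchIn ℓ r) (punchIn j c)) ≡ det (λ r c → A′ r (punchIn j c))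
  lower-rows j = trans (det-cong entries)
    (det-unitLowerTriangular-*ᴹ L′ M (λ r i → above≡0 _ _ ∘ punchIn-mono-< ℓ) (λ r → diag (punchIn ℓ r)))
    where
    M : Matrix m
    M r c = A′ r (punchIn j c)
    entries : ∀ r c → (L *ᴹ A) (punchIn ℓ r) (punchIn j c) ≡ (L′ *ᴹ M) r c
    entries r c = begin
      ∑ (λ i → L (punchIn ℓ r) i * A i (punchIn j c))
        ≡⟨ ∑-remove (λ i → L (punchIn ℓ r) i * A i (punchIn j c)) ℓ ⟩
      L (punchIn ℓ r) ℓ * A ℓ (punchIn j c) + (L′ *ᴹ M) r c
        ≡⟨ cong (λ x → x * A ℓ (punchIn j c) + (L′ *ᴹ M) r c) (above≡0 _ _ (punchIn-last-< r)) ⟩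
      + 0 * A ℓ (punchIn j c) + (L′ *ᴹ M) r c
        ≡⟨ ℤP.+-identityˡ _ ⟩
      (L′ *ᴹ M) r c ∎

det-topRowZero : ∀ {n} (A : Matrix (suc n)) → (∀ j → A zero (suc j) ≡ + 0) →
                 det A ≡ A zero zero * det (minor A zero)
det-topRowZero A top≡0 = begin
  laplaceTerm A zero + ∑ (laplaceTerm A ∘ suc)  ≡⟨ cong (_+_ (laplaceTerm A zero)) (∑-zero _ vanish) ⟩
  laplaceTerm A zero + + 0                      ≡⟨ ℤP.+-identityʳ _ ⟩
  + 1 * A zero zero * det (minor A zero)        ≡⟨ cong (_* det (minor A zero)) (ℤP.*-identityˡ (A zero zero)) ⟩
  A zero zero * det (minor A zero)              ∎
  where
  open ≡-Reasoning
  vanish : ∀ j → laplaceTerm A (suc j) ≡ + 0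
  vanish j rewrite top≡0 j | ℤP.*-zeroʳ (sgn (suc j)) = refl

det-leftColumnZero : ∀ {n} (A : Matrix (suc n)) → (∀ i → A (suc i) zero ≡ + 0) →
                     det A ≡ A zero zero * det (λ r c → A (suc r) (suc c))
det-leftColumnZero A column≡0 = begin
  det A                      ≡⟨ det-ᵀ A ⟨
  det (A ᵀ)                  ≡⟨ det-topRowZero (A ᵀ) column≡0 ⟩
  A zero zero * det (A′ ᵀ)   ≡⟨ cong (A zero zero *_) (det-ᵀ A′) ⟩
  A zero zero * det A′       ∎
  where
  open ≡-Reasoning
  A′ = λ r c → A (suc r) (suc c)

det-lowerTriangular-isUnit : ∀ {n} (A : Matrix n) → (∀ i j → i F.< j → A i j ≡ + 0) →
                             (∀ i → IsUnit (A i i)) → IsUnit (det A)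
det-lowerTriangular-isUnit {zero} A _ _ = inj₁ refl
det-lowerTriangular-isUnit {suc n} A above≡0 diag =
  subst IsUnit (sym (det-topRowZero A (λ j → above≡0 zero (suc j) ℕ.z<s)))
    (isUnit-* (diag zero)
      (det-lowerTriangular-isUnit (minor A zero) (λ i j i<j → above≡0 (suc i) (suc j) (ℕ.s<s i<j)) (diag ∘ suc)))

det-upperTriangular-isUnit : ∀ {n} (A : Matrix n) → (∀ i j → j F.< i → A i j ≡ + 0) →
                             (∀ i → IsUnit (A i i)) → IsUnit (det A)
det-upperTriangular-isUnit A below≡0 diag =
  subst IsUnit (det-ᵀ A) (det-lowerTriangular-isUnit (A ᵀ) (λ i j → below≡0 j i) diag)

punchIn-↑ˡ-↑ʳ : ∀ {p q} (i : Fin (suc p)) (b : Fin q) → punchIn (i ↑ˡ q) (p ↑ʳ b) ≡ suc p ↑ʳ b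
punchIn-↑ˡ-↑ʳ zero b = refl
punchIn-↑ˡ-↑ʳ {suc p} (suc i) b = cong suc (punchIn-↑ˡ-↑ʳ i b)

punchIn-↑ˡ : ∀ {p q} (i : Fin (suc p)) (b : Fin p) → punchIn (i ↑ˡ q) (b ↑ˡ q) ≡ punchIn i b ↑ˡ q
punchIn-↑ˡ zero b = refl
punchIn-↑ˡ (suc i) zero = refl
punchIn-↑ˡ (suc i) (suc b) = cong suc (punchIn-↑ˡ i b)

det-blockLowerTriangular : ∀ p {q} (A : Matrix (p ℕ.+ q)) → (∀ i j → A (i ↑ˡ q) (p ↑ʳ j) ≡ + 0) →
  det A ≡ det (λ i j → A (i ↑ˡ q) (j ↑ˡ q)) * det (λ i j → A (p ↑ʳ i) (p ↑ʳ j))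
det-blockLowerTriangular zero A _ = sym (ℤP.*-identityˡ (det A))
det-blockLowerTriangular (suc p) {q} A corner≡0 = begin
  ∑ (laplaceTerm A)
    ≡⟨ ∑-splitAt (suc p) (laplaceTerm A) ⟩
  ∑ (λ i → laplaceTerm A (i ↑ˡ q)) + ∑ (λ j → laplaceTerm A (suc p ↑ʳ j))
    ≡⟨ cong₂ _+_ (∑-cong left-term) (∑-zero _ right-term) ⟩
  ∑ (λ i → laplaceTerm TL i * det BR) + + 0
    ≡⟨ ℤP.+-identityʳ _ ⟩
  ∑ (λ i → laplaceTerm TL i * det BR)
    ≡⟨ ∑-cong (λ i → ℤP.*-comm (laplaceTerm TL i) (det BR)) ⟩
  ∑ (λ i → det BR * laplaceTerm TL i)
    ≡⟨ *-distribˡ-∑ (det BR) (laplaceTerm TL) ⟨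
  det BR * det TL
    ≡⟨ ℤP.*-comm (det BR) (det TL) ⟩
  det TL * det BR ∎
  where
  open ≡-Reasoning
  TL : Matrix (suc p)
  TL i j = A (i ↑ˡ q) (j ↑ˡ q)
  BR : Matrix q
  BR i j = A (suc p ↑ʳ i) (suc p ↑ʳ j)
  right-term : ∀ j → laplaceTerm A (suc p ↑ʳ j) ≡ + 0
  right-term j rewrite corner≡0 zero j | ℤP.*-zeroʳ (sgn (suc p ↑ʳ j)) = refl
  left-term : ∀ i → laplaceTerm A (i ↑ˡ q) ≡ laplaceTerm TL i * det BR
  left-term i = begin
    sgn (i ↑ˡ q) * A zero (i ↑ˡ q) * det (minor A (i ↑ˡ q))
      ≡⟨ cong₂ (λ k d → sign k * TL zero i * d) (FP.toℕ-↑ˡ i q)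
           (det-blockLowerTriangular p (minor A (i ↑ˡ q))
             (λ a b → trans (cong (A (suc (a ↑ˡ q))) (punchIn-↑ˡ-↑ʳ i b)) (corner≡0 (suc a) b))) ⟩
    sgn i * TL zero i * (det (λ a b → A (suc (a ↑ˡ q)) (punchIn (i ↑ˡ q) (b ↑ˡ q)))
                         * det (λ a b → A (suc (p ↑ʳ a)) (punchIn (i ↑ˡ q) (p ↑ʳ b))))
      ≡⟨ cong₂ (λ d d′ → sgn i * TL zero i * (d * d′))
           (det-cong (λ a b → cong (A (suc (a ↑ˡ q))) (punchIn-↑ˡ i b)))
           (det-cong (λ a b → cong (A (suc (p ↑ʳ a))) (punchIn-↑ˡ-↑ʳ i b))) ⟩
    sgn i * TL zero i * (det (minor TL i) * det BR)
      ≡⟨ ℤP.*-assoc (sgn i * TL zero i) (det (minor TL i)) (det BR) ⟨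
    laplaceTerm TL i * det BR ∎

det-permuteBlocks : ∀ p q (M : Matrix (p ℕ.+ q)) {ρ κ : Fin (p ℕ.+ q) → Fin (p ℕ.+ q)} →
  Injective _≡_ _≡_ ρ → Injective _≡_ _≡_ κ → (∀ i j → M (ρ (i ↑ˡ q)) (κ (p ↑ʳ j)) ≡ + 0) →
  det M ≡± det (λ i j → M (ρ (i ↑ˡ q)) (κ (j ↑ˡ q))) * det (λ i j → M (ρ (p ↑ʳ i)) (κ (p ↑ʳ j)))
det-permuteBlocks p q M {ρ} {κ} ρ-inj κ-inj corner≡0
  with injective⇒scalesDet ρ-inj | injective⇒scalesDet κ-inj
... | ε₁ , ε₁-unit , ρ-scales | ε₂ , ε₂-unit , κ-scales =
  ε₁ * ε₂ , ε-unit ,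
  trans (isUnit-flip ε-unit permuted) (cong (ε₁ * ε₂ *_) (det-blockLowerTriangular p M′ corner≡0))
  where
  open ≡-Reasoning
  ε-unit = isUnit-* ε₁-unit ε₂-unit
  M′ : Matrix (p ℕ.+ q)
  M′ r c = M (ρ r) (κ c)
  permuted : det M′ ≡ ε₁ * ε₂ * det M
  permuted = begin
    det M′                        ≡⟨ ρ-scales (λ r c → M r (κ c)) ⟩
    ε₁ * det (λ r c → M r (κ c))  ≡⟨ cong (ε₁ *_) (det-ᵀ (M ᵀ ∘ κ)) ⟩
    ε₁ * det (M ᵀ ∘ κ)            ≡⟨ cong (ε₁ *_) (κ-scales (M ᵀ)) ⟩
    ε₁ * (ε₂ * det (M ᵀ))         ≡⟨ cong (λ d → ε₁ * (ε₂ * d)) (det-ᵀ M) ⟩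
    ε₁ * (ε₂ * det M)             ≡⟨ ℤP.*-assoc ε₁ ε₂ (det M) ⟨
    ε₁ * ε₂ * det M               ∎

ballot : ℕ → ℕ → ℕ
ballot zero zero = 1
ballot zero (suc k) = 0
ballot (suc j) zero = ballot j 1
ballot (suc j) (suc k) = ballot j (suc (suc k)) ℕ.+ ballot j k

ballot-< : ∀ {j k} → j ℕ.< k → ballot j k ≡ 0
ballot-< {zero} {suc k} _ = refl
ballot-< {suc j} {suc k} (ℕ.s≤s j<k) =
  cong₂ ℕ._+_ (ballot-< (ℕP.m<n⇒m<1+n (ℕP.m<n⇒m<1+n j<k))) (ballot-< j<k)

ballot-diag : ∀ k → ballot k k ≡ 1
ballot-diag zero = refl
ballot-diag (suc k) = cong₂ ℕ._+_ (ballot-< (ℕP.m<n⇒m<1+n (ℕP.n<1+n k))) (ballot-diag k)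

ballot-odd : ∀ j k → (j ℕ.+ k) ℕ.% 2 ≡ 1 → ballot j k ≡ 0
ballot-odd zero zero ()
ballot-odd zero (suc k) _ = refl
ballot-odd (suc j) zero j+1-odd =
  ballot-odd j 1 (trans (cong (ℕ._% 2) (trans (ℕP.+-comm j 1) (sym (ℕP.+-identityʳ (suc j))))) j+1-odd)
ballot-odd (suc j) (suc k) j+k+2-odd =
  cong₂ ℕ._+_ (ballot-odd j (suc (suc k)) (trans (cong (ℕ._% 2) j+[k+2]≡j+k+2) j+k-odd)) (ballot-odd j k j+k-odd)
  where
  j+[k+2]≡j+k+2 : j ℕ.+ suc (suc k) ≡ suc (suc (j ℕ.+ k))
  j+[k+2]≡j+k+2 = trans (ℕP.+-suc j (suc k)) (cong suc (ℕP.+-suc j k))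
  j+k-odd : (j ℕ.+ k) ℕ.% 2 ≡ 1
  j+k-odd = trans (cong (ℕ._% 2) (sym (cong suc (ℕP.+-suc j k)))) j+k+2-odd

C-sym : ∀ {n} k l → k ℕ.+ l ≡ n → n C k ≡ n C l
C-sym k l refl = trans (nCk≡nC[n∸k] (ℕP.m≤m+n k l)) (cong ((k ℕ.+ l) C_) (ℕP.m+n∸m≡n k l))

binomPrev : ℕ → ℕ → ℕ
binomPrev n zero = 0
binomPrev n (suc d) = n C d

pascal-prev : ∀ n d → binomPrev n d ℕ.+ n C d ≡ suc n C d
pascal-prev n zero = refl
pascal-prev n (suc d) = pascal n d

C-oddCentral : ∀ d → suc (2 ℕ.* d) C d ≡ suc (2 ℕ.* d) C suc d
C-oddCentral d = C-sym d (suc d) (d+[d+1]≡2d+1 d)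
  where
  d+[d+1]≡2d+1 : ∀ d → d ℕ.+ suc d ≡ suc (2 ℕ.* d)
  d+[d+1]≡2d+1 = ℕS.solve-∀

-- The reflection principle.
ballot-reflection : ∀ d k →
  ballot (k ℕ.+ 2 ℕ.* d) k ℕ.+ binomPrev (k ℕ.+ 2 ℕ.* d) d ≡ (k ℕ.+ 2 ℕ.* d) C d
ballot-reflection zero k = subst (λ N → ballot N k ℕ.+ 0 ≡ N C 0) (sym (ℕP.+-identityʳ k))
  (trans (ℕP.+-identityʳ (ballot k k)) (ballot-diag k))
ballot-reflection (suc d) (suc k) = begin
  (ballot N (suc (suc k)) ℕ.+ ballot N k) ℕ.+ suc N C d
    ≡⟨ cong ((ballot N (suc (suc k)) ℕ.+ ballot N k) ℕ.+_) (pascal-prev N d) ⟨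
  (ballot N (suc (suc k)) ℕ.+ ballot N k) ℕ.+ (binomPrev N d ℕ.+ N C d)
    ≡⟨ interchange (ballot N (suc (suc k))) (ballot N k) (binomPrev N d) (N C d) ⟩
  (ballot N (suc (suc k)) ℕ.+ binomPrev N d) ℕ.+ (ballot N k ℕ.+ N C d)
    ≡⟨ cong₂ ℕ._+_ higher (ballot-reflection (suc d) k) ⟩
  N C d ℕ.+ N C suc d
    ≡⟨ pascal N d ⟩
  suc N C suc d ∎
  where
  open ≡-Reasoning
  N = k ℕ.+ 2 ℕ.* suc d
  k+2+2d≡N : ∀ k d → suc (suc k) ℕ.+ 2 ℕ.* d ≡ k ℕ.+ 2 ℕ.* suc d
  k+2+2d≡N = ℕS.solve-∀
  higher : ballot N (suc (suc k)) ℕ.+ binomPrev N d ≡ N C d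
  higher = subst (λ M → ballot M (suc (suc k)) ℕ.+ binomPrev M d ≡ M C d) (k+2+2d≡N k d)
    (ballot-reflection d (suc (suc k)))
  interchange : ∀ x y z w → (x ℕ.+ y) ℕ.+ (z ℕ.+ w) ≡ (x ℕ.+ z) ℕ.+ (y ℕ.+ w)
  interchange = ℕS.solve-∀
ballot-reflection (suc d) zero =
  subst (λ N → ballot N 0 ℕ.+ binomPrev N (suc d) ≡ N C suc d) (sym (2[d+1]≡2d+2 d)) (begin
    ballot M 1 ℕ.+ suc M C d                  ≡⟨ cong (ballot M 1 ℕ.+_) (pascal-prev M d) ⟨
    ballot M 1 ℕ.+ (binomPrev M d ℕ.+ M C d)  ≡⟨ ℕP.+-assoc (ballot M 1) (binomPrev M d) (M C d) ⟨
    (ballot M 1 ℕ.+ binomPrev M d) ℕ.+ M C d  ≡⟨ cong₂ ℕ._+_ (ballot-reflection d 1) (C-oddCentral d) ⟩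
    M C d ℕ.+ M C suc d                       ≡⟨ pascal M d ⟩
    suc M C suc d                             ∎)
  where
  open ≡-Reasoning
  M = suc (2 ℕ.* d)
  2[d+1]≡2d+2 : ∀ d → 2 ℕ.* suc d ≡ suc (suc (2 ℕ.* d))
  2[d+1]≡2d+2 = ℕS.solve-∀

absorption : ∀ n k → suc k ℕ.* (suc n C suc k) ≡ suc n ℕ.* (n C k)
absorption zero zero = refl
absorption zero (suc k) = ℕP.*-zeroʳ (suc (suc k))
absorption (suc n) zero =
  trans (ℕP.+-identityʳ _) (trans (nC1≡n (suc (suc n))) (sym (ℕP.*-identityʳ (suc (suc n)))))
absorption (suc n) (suc k) = begin
  suc (suc k) ℕ.* (suc N C suc (suc k))
    ≡⟨ cong (suc (suc k) ℕ.*_) (pascal N (suc k)) ⟨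
  suc (suc k) ℕ.* (a ℕ.+ b)
    ≡⟨ expand k a b ⟩
  a ℕ.+ (suc k ℕ.* a ℕ.+ suc (suc k) ℕ.* b)
    ≡⟨ cong (a ℕ.+_) (cong₂ ℕ._+_ (absorption n k) (absorption n (suc k))) ⟩
  a ℕ.+ (N ℕ.* (n C k) ℕ.+ N ℕ.* (n C suc k))
    ≡⟨ cong (a ℕ.+_) (ℕP.*-distribˡ-+ N (n C k) (n C suc k)) ⟨
  a ℕ.+ N ℕ.* (n C k ℕ.+ n C suc k)
    ≡⟨ cong (λ x → a ℕ.+ N ℕ.* x) (pascal n k) ⟩
  a ℕ.+ N ℕ.* a ∎
  where
  open ≡-Reasoning
  N = suc n
  a = N C suc k
  b = N C suc (suc k)
  expand : ∀ k a b → suc (suc k) ℕ.* (a ℕ.+ b) ≡ a ℕ.+ (suc k ℕ.* a ℕ.+ suc (suc k) ℕ.* b)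
  expand = ℕS.solve-∀

suc-*-binomPrev-central : ∀ m → suc m ℕ.* binomPrev (2 ℕ.* m) m ≡ m ℕ.* ((2 ℕ.* m) C m)
suc-*-binomPrev-central zero = refl
suc-*-binomPrev-central (suc t) =
  subst (λ N → suc (suc t) ℕ.* (N C t) ≡ suc t ℕ.* (N C suc t)) (sym (2[t+1]≡2t+2 t)) (begin
    suc (suc t) ℕ.* (suc L C t)            ≡⟨ cong (suc (suc t) ℕ.*_) (C-sym t (suc (suc t)) (t+t+2≡2t+2 t)) ⟩
    suc (suc t) ℕ.* (suc L C suc (suc t))  ≡⟨ absorption L (suc t) ⟩
    suc L ℕ.* (L C suc t)                  ≡⟨ cong (suc L ℕ.*_) (C-oddCentral t) ⟨
    suc L ℕ.* (L C t)                      ≡⟨ absorption L t ⟨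
    suc t ℕ.* (suc L C suc t)              ∎)
  where
  open ≡-Reasoning
  L = suc (2 ℕ.* t)
  2[t+1]≡2t+2 : ∀ t → 2 ℕ.* suc t ≡ suc (suc (2 ℕ.* t))
  2[t+1]≡2t+2 = ℕS.solve-∀
  t+t+2≡2t+2 : ∀ t → t ℕ.+ suc (suc t) ≡ suc (suc (2 ℕ.* t))
  t+t+2≡2t+2 = ℕS.solve-∀

catalan≡ballot : ∀ m → catalan m ≡ ballot (m ℕ.+ m) 0
catalan≡ballot m = begin
  X ℕ./ suc m              ≡⟨ cong (ℕ._/ suc m) X≡b*[m+1] ⟩
  b ℕ.* suc m ℕ./ suc m    ≡⟨ ND.m*n/n≡m b (suc m) ⟩
  b                        ≡⟨ cong (λ n → ballot n 0) (cong (m ℕ.+_) (ℕP.+-identityʳ m)) ⟩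
  ballot (m ℕ.+ m) 0       ∎
  where
  open ≡-Reasoning
  X = (2 ℕ.* m) C m
  b = ballot (2 ℕ.* m) 0
  X+mX≡[m+1]b+mX : X ℕ.+ m ℕ.* X ≡ suc m ℕ.* b ℕ.+ m ℕ.* X
  X+mX≡[m+1]b+mX = begin
    suc m ℕ.* X                                      ≡⟨ cong (suc m ℕ.*_) (ballot-reflection m 0) ⟨
    suc m ℕ.* (b ℕ.+ binomPrev (2 ℕ.* m) m)          ≡⟨ ℕP.*-distribˡ-+ (suc m) b _ ⟩
    suc m ℕ.* b ℕ.+ suc m ℕ.* binomPrev (2 ℕ.* m) m
      ≡⟨ cong (suc m ℕ.* b ℕ.+_) (suc-*-binomPrev-central m) ⟩
    suc m ℕ.* b ℕ.+ m ℕ.* X                          ∎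
  X≡b*[m+1] : X ≡ b ℕ.* suc m
  X≡b*[m+1] = trans (ℕP.+-cancelʳ-≡ (m ℕ.* X) X (suc m ℕ.* b) X+mX≡[m+1]b+mX) (ℕP.*-comm (suc m) b)

data Parity : ℕ → Set where
  even : ∀ m → Parity (m ℕ.+ m)
  odd  : ∀ m → Parity (suc (m ℕ.+ m))

parity : ∀ n → Parity n
parity zero = even 0
parity (suc n) with parity n
... | even m = odd m
... | odd m = subst Parity (cong suc (ℕP.+-suc m m)) (even (suc m))

m+m≡m*2 : ∀ m → m ℕ.+ m ≡ m ℕ.* 2
m+m≡m*2 = ℕS.solve-∀

[m+m]%2≡0 : ∀ m → (m ℕ.+ m) ℕ.% 2 ≡ 0
[m+m]%2≡0 m = trans (cong (ℕ._% 2) (m+m≡m*2 m)) (ND.m*n%n≡0 m 2)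

[1+m+m]%2≡1 : ∀ m → suc (m ℕ.+ m) ℕ.% 2 ≡ 1
[1+m+m]%2≡1 m = trans (cong (λ n → suc n ℕ.% 2) (m+m≡m*2 m)) (ND.[m+kn]%n≡m%n 1 m 2)

c-even : ∀ m → c (m ℕ.+ m) ≡ sign m * + catalan m
c-even m = trans (unfold (m ℕ.+ m) ([m+m]%2≡0 m)) (cong (λ h → sign h * + catalan h) [m+m]/2≡m)
  where
  unfold : ∀ n → n ℕ.% 2 ≡ 0 → c n ≡ sign (n ℕ./ 2) * + catalan (n ℕ./ 2)
  unfold n n%2≡0 rewrite n%2≡0 = refl
  [m+m]/2≡m : (m ℕ.+ m) ℕ./ 2 ≡ m
  [m+m]/2≡m = trans (cong (ℕ._/ 2) (m+m≡m*2 m)) (ND.m*n/n≡m m 2)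

c-odd : ∀ m → c (suc (m ℕ.+ m)) ≡ + 0
c-odd m = unfold (suc (m ℕ.+ m)) ([1+m+m]%2≡1 m)
  where
  unfold : ∀ n → n ℕ.% 2 ≡ 1 → c n ≡ + 0
  unfold n n%2≡1 rewrite n%2≡1 = refl

-- The sign makes c j = signedBallot j 0 and turns the recursion of ballot into
-- signedBallot (j+1) (k+1) = signedBallot j (k+2) - signedBallot j k.
signedBallot : ℕ → ℕ → ℤ
signedBallot j k = sign ℕ.⌊ j ℕ.+ k /2⌋ * + ballot j k

signedBallot-< : ∀ {j k} → j ℕ.< k → signedBallot j k ≡ + 0
signedBallot-< {j} {k} j<k rewrite ballot-< j<k = ℤP.*-zeroʳ (sign ℕ.⌊ j ℕ.+ k /2⌋)

signedBallot-odd : ∀ j k → (j ℕ.+ k) ℕ.% 2 ≡ 1 → signedBallot j k ≡ + 0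
signedBallot-odd j k j+k-odd rewrite ballot-odd j k j+k-odd = ℤP.*-zeroʳ (sign ℕ.⌊ j ℕ.+ k /2⌋)

signedBallot-diag : ∀ k → signedBallot k k ≡ sign k
signedBallot-diag k rewrite ballot-diag k | sym (ℕP.n≡⌊n+n/2⌋ k) = ℤP.*-identityʳ (sign k)

signedBallot-suc-zero : ∀ j → signedBallot (suc j) 0 ≡ signedBallot j 1
signedBallot-suc-zero j =
  cong (λ n → sign ℕ.⌊ n /2⌋ * + ballot j 1) (trans (ℕP.+-identityʳ (suc j)) (ℕP.+-comm 1 j))

signedBallot-suc-suc : ∀ j k → signedBallot (suc j) (suc k) + signedBallot j k ≡ signedBallot j (suc (suc k))
signedBallot-suc-suc j k
  rewrite ℕP.+-suc j k | ℕP.+-suc j (suc k) | ℕP.+-suc j k | ℤP.pos-+ (ballot j (suc (suc k))) (ballot j k)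
  = cancel (sign ℕ.⌊ j ℕ.+ k /2⌋) (+ ballot j (suc (suc k))) (+ ballot j k)
  where
  cancel : ∀ s x y → - s * (x + y) + s * y ≡ - s * x
  cancel = solve-∀

c≡signedBallot : ∀ j → c j ≡ signedBallot j 0
c≡signedBallot j with parity j
... | even m = begin
  c (m ℕ.+ m)                                  ≡⟨ c-even m ⟩
  sign m * + catalan m
    ≡⟨ cong₂ (λ h b → sign h * + b) (ℕP.n≡⌊n+n/2⌋ m) (catalan≡ballot m) ⟩
  sign ℕ.⌊ m ℕ.+ m /2⌋ * + ballot (m ℕ.+ m) 0
    ≡⟨ cong (λ n → sign ℕ.⌊ n /2⌋ * + ballot (m ℕ.+ m) 0) (ℕP.+-identityʳ (m ℕ.+ m)) ⟨
  signedBallot (m ℕ.+ m) 0                     ∎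
  where open ≡-Reasoning
... | odd m = trans (c-odd m) (sym (signedBallot-odd (suc (m ℕ.+ m)) 0
  (trans (cong (ℕ._% 2) (ℕP.+-identityʳ (suc (m ℕ.+ m)))) ([1+m+m]%2≡1 m))))

-- fibCoeff k i is the coefficient of x^i in the Fibonacci polynomial F_{k+1}.
fibCoeff : ℕ → ℕ → ℤ
fibCoeff zero zero = + 1
fibCoeff zero (suc i) = + 0
fibCoeff (suc zero) zero = + 0
fibCoeff (suc zero) (suc i) = fibCoeff zero i
fibCoeff (suc (suc k)) zero = fibCoeff k zero
fibCoeff (suc (suc k)) (suc i) = fibCoeff (suc k) i + fibCoeff k (suc i)

fibCoeff-> : ∀ {k i} → k ℕ.< i → fibCoeff k i ≡ + 0
fibCoeff-> {zero} {suc i} _ = refl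
fibCoeff-> {suc zero} {suc i} (ℕ.s≤s 0<i) = fibCoeff-> 0<i
fibCoeff-> {suc (suc k)} {suc i} (ℕ.s≤s k+1<i) =
  cong₂ _+_ (fibCoeff-> k+1<i) (fibCoeff-> (ℕP.m<n⇒m<1+n (ℕP.<-trans (ℕP.n<1+n k) k+1<i)))

fibCoeff-diag : ∀ k → fibCoeff k k ≡ + 1
fibCoeff-diag zero = refl
fibCoeff-diag (suc zero) = refl
fibCoeff-diag (suc (suc k)) = cong₂ _+_ (fibCoeff-diag (suc k)) (fibCoeff-> (ℕP.m<n⇒m<1+n (ℕP.n<1+n k)))

-- For the functional xⁿ ↦ c n this says x^j F_{k+1}(x) ↦ signedBallot j k.
∑-fibCoeff-c : ∀ {N} k j → k ℕ.< N →
               ∑ {N} (λ i → fibCoeff k (toℕ i) * c (toℕ i ℕ.+ j)) ≡ signedBallot j k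
∑-fibCoeff-c {suc N} zero j _ = begin
  + 1 * c j + ∑ {N} (λ i → + 0 * c (suc (toℕ i) ℕ.+ j))
    ≡⟨ cong₂ _+_ (ℤP.*-identityˡ (c j))
                 (∑-zero {N} (λ i → + 0 * c (suc (toℕ i) ℕ.+ j)) (λ i → refl)) ⟩
  c j + + 0         ≡⟨ ℤP.+-identityʳ (c j) ⟩
  c j               ≡⟨ c≡signedBallot j ⟩
  signedBallot j 0  ∎
  where open ≡-Reasoning
∑-fibCoeff-c {suc (suc N)} (suc zero) j _ = begin
  + 0 * c j + (+ 1 * c (suc j) + ∑ {N} (λ i → + 0 * c (suc (suc (toℕ i)) ℕ.+ j)))
    ≡⟨ cong (λ s → + 0 * c j + (+ 1 * c (suc j) + s))
            (∑-zero {N} (λ i → + 0 * c (suc (suc (toℕ i)) ℕ.+ j)) (λ i → refl)) ⟩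
  + 0 * c j + (+ 1 * c (suc j) + + 0)  ≡⟨ only-middle (c j) (c (suc j)) ⟩
  c (suc j)                            ≡⟨ c≡signedBallot (suc j) ⟩
  signedBallot (suc j) 0               ≡⟨ signedBallot-suc-zero j ⟩
  signedBallot j 1                     ∎
  where
  open ≡-Reasoning
  only-middle : ∀ x y → + 0 * x + (+ 1 * y + + 0) ≡ y
  only-middle = solve-∀
∑-fibCoeff-c {suc N} (suc (suc k)) j (ℕ.s≤s k+2≤N) = begin
  fibCoeff k 0 * c j + ∑ (λ i → (F′ i + F″ i) * c (suc (toℕ i ℕ.+ j)))
    ≡⟨ cong (_+_ (fibCoeff k 0 * c j)) split ⟩
  fibCoeff k 0 * c j + (X + Y)
    ≡⟨ rotate (fibCoeff k 0 * c j) X Y ⟩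
  X + (fibCoeff k 0 * c j + Y)
    ≡⟨ cong (_+ (fibCoeff k 0 * c j + Y))
            (∑-cong (λ i → cong (λ n → F′ i * c n) (sym (ℕP.+-suc (toℕ i) j)))) ⟩
  ∑ (λ i → F′ i * c (toℕ i ℕ.+ suc j)) + ∑ {suc N} (λ i → fibCoeff k (toℕ i) * c (toℕ i ℕ.+ j))
    ≡⟨ cong₂ _+_ (∑-fibCoeff-c (suc k) (suc j) k+2≤N)
                 (∑-fibCoeff-c k j (ℕP.<-trans (ℕP.n<1+n k) (ℕ.s≤s (ℕP.<⇒≤ k+2≤N)))) ⟩
  signedBallot (suc j) (suc k) + signedBallot j k
    ≡⟨ signedBallot-suc-suc j k ⟩
  signedBallot j (suc (suc k)) ∎
  where
  open ≡-Reasoning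
  F′ F″ : Fin N → ℤ
  F′ i = fibCoeff (suc k) (toℕ i)
  F″ i = fibCoeff k (suc (toℕ i))
  X = ∑ (λ i → F′ i * c (suc (toℕ i ℕ.+ j)))
  Y = ∑ (λ i → F″ i * c (suc (toℕ i ℕ.+ j)))
  split : ∑ (λ i → (F′ i + F″ i) * c (suc (toℕ i ℕ.+ j))) ≡ X + Y
  split = trans (∑-cong (λ i → ℤP.*-distribʳ-+ (c (suc (toℕ i ℕ.+ j))) (F′ i) (F″ i)))
                (∑-+ (λ i → F′ i * c (suc (toℕ i ℕ.+ j))) (λ i → F″ i * c (suc (toℕ i ℕ.+ j))))
  rotate : ∀ a x y → a + (x + y) ≡ x + (a + y)
  rotate = solve-∀

det-H₁-isUnit : ∀ n → IsUnit (det (H₁ n))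
det-H₁-isUnit n =
  subst IsUnit (det-unitLowerTriangular-*ᴹ F (H₁ n) (λ k i → fibCoeff->) (fibCoeff-diag ∘ toℕ))
    (det-upperTriangular-isUnit (F *ᴹ H₁ n)
      (λ i j j<i → trans (entries i j) (signedBallot-< j<i))
      (λ i → subst IsUnit (sym (trans (entries i i) (signedBallot-diag (toℕ i)))) (sign-isUnit (toℕ i))))
  where
  F : Matrix n
  F k i = fibCoeff (toℕ k) (toℕ i)
  entries : ∀ k j → (F *ᴹ H₁ n) k j ≡ signedBallot (toℕ j) (toℕ k)
  entries k j = ∑-fibCoeff-c (toℕ k) (toℕ j) (FP.toℕ<n k)

conv : (ℕ → ℕ) → (ℕ → ℕ) → ℕ → ℕ
conv f g zero = f 0 ℕ.* g 0
conv f g (suc j) = f 0 ℕ.* g (suc j) ℕ.+ conv (f ∘ suc) g j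

conv-distribʳ-+ : ∀ (f f′ g : ℕ → ℕ) j → conv (λ i → f i ℕ.+ f′ i) g j ≡ conv f g j ℕ.+ conv f′ g j
conv-distribʳ-+ f f′ g zero = ℕP.*-distribʳ-+ (g 0) (f 0) (f′ 0)
conv-distribʳ-+ f f′ g (suc j) = trans
  (cong₂ ℕ._+_ (ℕP.*-distribʳ-+ (g (suc j)) (f 0) (f′ 0)) (conv-distribʳ-+ (f ∘ suc) (f′ ∘ suc) g j))
  (interchange (f 0 ℕ.* g (suc j)) (f′ 0 ℕ.* g (suc j)) (conv (f ∘ suc) g j) (conv (f′ ∘ suc) g j))
  where
  interchange : ∀ a b c d → (a ℕ.+ b) ℕ.+ (c ℕ.+ d) ≡ (a ℕ.+ c) ℕ.+ (b ℕ.+ d)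
  interchange = ℕS.solve-∀

-- Split a path at its first visit to height k.
ballot-firstVisit : ∀ j k → ballot (suc j) (suc k) ≡ conv (λ i → ballot i k) (λ t → ballot t 0) j
ballot-firstVisit zero k = sym (ℕP.*-identityʳ (ballot 0 k))
ballot-firstVisit (suc j) zero = begin
  ballot (suc j) 2 ℕ.+ ballot (suc j) 0       ≡⟨ cong (ℕ._+ ballot (suc j) 0) (ballot-firstVisit j 1) ⟩
  conv B₁ D₀ j ℕ.+ ballot (suc j) 0           ≡⟨ ℕP.+-comm (conv B₁ D₀ j) (ballot (suc j) 0) ⟩
  ballot (suc j) 0 ℕ.+ conv B₁ D₀ j           ≡⟨ cong (ℕ._+ conv B₁ D₀ j) (ℕP.*-identityˡ (ballot (suc j) 0)) ⟨
  1 ℕ.* ballot (suc j) 0 ℕ.+ conv B₁ D₀ j     ∎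
  where
  open ≡-Reasoning
  B₁ D₀ : ℕ → ℕ
  B₁ t = ballot t 1
  D₀ t = ballot t 0
ballot-firstVisit (suc j) (suc k) =
  trans (cong₂ ℕ._+_ (ballot-firstVisit j (suc (suc k))) (ballot-firstVisit j k))
        (sym (conv-distribʳ-+ (λ i → ballot i (suc (suc k))) (λ i → ballot i k) (λ t → ballot t 0) j))

conv-snoc : ∀ (f g : ℕ → ℕ) j → conv f g (suc j) ≡ conv f (g ∘ suc) j ℕ.+ f (suc j) ℕ.* g 0
conv-snoc f g zero = refl
conv-snoc f g (suc j) = trans (cong (f 0 ℕ.* g (suc (suc j)) ℕ.+_) (conv-snoc (f ∘ suc) g j))
                              (sym (ℕP.+-assoc (f 0 ℕ.* g (suc (suc j))) _ _))

conv-self-suc-suc : ∀ (f : ℕ → ℕ) j → conv f f (suc (suc j))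
                    ≡ (f 0 ℕ.* f (suc (suc j)) ℕ.+ f 0 ℕ.* f (suc (suc j))) ℕ.+ conv (f ∘ suc) (f ∘ suc) j
conv-self-suc-suc f j =
  trans (cong (f 0 ℕ.* f (suc (suc j)) ℕ.+_) (conv-snoc (f ∘ suc) f j))
        (regroup (f 0 ℕ.* f (suc (suc j))) (conv (f ∘ suc) (f ∘ suc) j) (f (suc (suc j))) (f 0))
  where
  regroup : ∀ a c x y → a ℕ.+ (c ℕ.+ x ℕ.* y) ≡ (a ℕ.+ y ℕ.* x) ℕ.+ c
  regroup = ℕS.solve-∀

-- The terms i and 2t - i of the symmetric sum pair up, leaving only the middle term.
conv-self-even : ∀ (f : ℕ → ℕ) t → ∃ λ q → conv f f (t ℕ.+ t) ≡ f t ℕ.* f t ℕ.+ (q ℕ.+ q)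
conv-self-even f zero = 0 , sym (ℕP.+-identityʳ _)
conv-self-even f (suc t) with conv-self-even (f ∘ suc) t
... | q , inner = x ℕ.+ q , (begin
  conv f f (suc t ℕ.+ suc t)                             ≡⟨ cong (conv f f) (cong suc (ℕP.+-suc t t)) ⟩
  conv f f (suc (suc (t ℕ.+ t)))                         ≡⟨ conv-self-suc-suc f (t ℕ.+ t) ⟩
  (x ℕ.+ x) ℕ.+ conv (f ∘ suc) (f ∘ suc) (t ℕ.+ t)       ≡⟨ cong ((x ℕ.+ x) ℕ.+_) inner ⟩
  (x ℕ.+ x) ℕ.+ (f (suc t) ℕ.* f (suc t) ℕ.+ (q ℕ.+ q))  ≡⟨ regroup x (f (suc t) ℕ.* f (suc t)) q ⟩
  f (suc t) ℕ.* f (suc t) ℕ.+ ((x ℕ.+ q) ℕ.+ (x ℕ.+ q))  ∎)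
  where
  open ≡-Reasoning
  x = f 0 ℕ.* f (suc (suc (t ℕ.+ t)))
  regroup : ∀ x s q → (x ℕ.+ x) ℕ.+ (s ℕ.+ (q ℕ.+ q)) ≡ s ℕ.+ ((x ℕ.+ q) ℕ.+ (x ℕ.+ q))
  regroup = ℕS.solve-∀

[m*m+q+q]%2≡m%2 : ∀ m q → (m ℕ.* m ℕ.+ (q ℕ.+ q)) ℕ.% 2 ≡ m ℕ.% 2
[m*m+q+q]%2≡m%2 m q = begin
  (m ℕ.* m ℕ.+ (q ℕ.+ q)) ℕ.% 2   ≡⟨ cong (λ x → (m ℕ.* m ℕ.+ x) ℕ.% 2) (m+m≡m*2 q) ⟩
  (m ℕ.* m ℕ.+ q ℕ.* 2) ℕ.% 2     ≡⟨ ND.[m+kn]%n≡m%n (m ℕ.* m) q 2 ⟩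
  (m ℕ.* m) ℕ.% 2                 ≡⟨ ND.%-distribˡ-* m m 2 ⟩
  (m ℕ.% 2 ℕ.* (m ℕ.% 2)) ℕ.% 2   ≡⟨ idempotent (m ℕ.% 2) (ND.m%n<n m 2) ⟩
  m ℕ.% 2                         ∎
  where
  open ≡-Reasoning
  idempotent : ∀ r → r ℕ.< 2 → (r ℕ.* r) ℕ.% 2 ≡ r
  idempotent zero _ = refl
  idempotent (suc zero) _ = refl
  idempotent (suc (suc r)) (ℕ.s≤s (ℕ.s≤s ()))

catalan-oddIndex-%2 : ∀ k → catalan (suc (k ℕ.+ k)) ℕ.% 2 ≡ catalan k ℕ.% 2
catalan-oddIndex-%2 k with conv-self-even (λ n → ballot n 0) (k ℕ.+ k)
... | q , square = begin
  catalan (suc (k ℕ.+ k)) ℕ.% 2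
    ≡⟨ cong (ℕ._% 2) (trans (catalan≡ballot (suc (k ℕ.+ k))) (cong D₀ (index k))) ⟩
  D₀ (suc (suc (t ℕ.+ t))) ℕ.% 2
    ≡⟨ cong (ℕ._% 2) (trans (ballot-firstVisit (t ℕ.+ t) 0) square) ⟩
  (D₀ t ℕ.* D₀ t ℕ.+ (q ℕ.+ q)) ℕ.% 2
    ≡⟨ [m*m+q+q]%2≡m%2 (D₀ t) q ⟩
  D₀ t ℕ.% 2
    ≡⟨ cong (ℕ._% 2) (catalan≡ballot k) ⟨
  catalan k ℕ.% 2 ∎
  where
  open ≡-Reasoning
  D₀ = λ n → ballot n 0
  t = k ℕ.+ k
  index : ∀ k → suc (k ℕ.+ k) ℕ.+ suc (k ℕ.+ k) ≡ suc (suc ((k ℕ.+ k) ℕ.+ (k ℕ.+ k)))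
  index = ℕS.solve-∀

catalan-evenIndex-%2 : ∀ k → catalan (suc (suc (k ℕ.+ k))) ℕ.% 2 ≡ 0
catalan-evenIndex-%2 k with conv-self-even (λ n → ballot n 0) (suc (k ℕ.+ k))
... | q , square = begin
  catalan (suc (suc (k ℕ.+ k))) ℕ.% 2
    ≡⟨ cong (ℕ._% 2) (trans (catalan≡ballot (suc (suc (k ℕ.+ k)))) (cong D₀ (index k))) ⟩
  D₀ (suc (suc (t ℕ.+ t))) ℕ.% 2
    ≡⟨ cong (ℕ._% 2) (trans (ballot-firstVisit (t ℕ.+ t) 0) square) ⟩
  (D₀ t ℕ.* D₀ t ℕ.+ (q ℕ.+ q)) ℕ.% 2
    ≡⟨ cong (λ x → (x ℕ.* x ℕ.+ (q ℕ.+ q)) ℕ.% 2) (ballot-odd t 0 t+0-odd) ⟩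
  (q ℕ.+ q) ℕ.% 2
    ≡⟨ [m+m]%2≡0 q ⟩
  0 ∎
  where
  open ≡-Reasoning
  D₀ = λ n → ballot n 0
  t = suc (k ℕ.+ k)
  index : ∀ k → suc (suc (k ℕ.+ k)) ℕ.+ suc (suc (k ℕ.+ k)) ≡ suc (suc (suc (k ℕ.+ k) ℕ.+ suc (k ℕ.+ k)))
  index = ℕS.solve-∀
  t+0-odd : (t ℕ.+ 0) ℕ.% 2 ≡ 1
  t+0-odd = trans (cong (ℕ._% 2) (ℕP.+-identityʳ t)) ([1+m+m]%2≡1 k)

aerate : (ℕ → ℤ) → ℕ → ℤ
aerate a zero = a 0
aerate a (suc zero) = + 0
aerate a (suc (suc n)) = aerate (a ∘ suc) n

aerate-even : ∀ a m → aerate a (m ℕ.+ m) ≡ a m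
aerate-even a zero = refl
aerate-even a (suc m) = trans (cong (λ n → aerate a (suc n)) (ℕP.+-suc m m)) (aerate-even (a ∘ suc) m)

aerate-odd : ∀ a m → aerate a (suc (m ℕ.+ m)) ≡ + 0
aerate-odd a zero = refl
aerate-odd a (suc m) = trans (cong (λ n → aerate a (suc (suc n))) (ℕP.+-suc m m)) (aerate-odd (a ∘ suc) m)

catalanParity : ℕ → ℤ
catalanParity m = + (catalan m ℕ.% 2)

catalanParity-suc : ∀ n → catalanParity (suc n) ≡ aerate catalanParity n
catalanParity-suc n with parity n
... | even m = trans (cong +_ (catalan-oddIndex-%2 m)) (sym (aerate-even catalanParity m))
... | odd m = trans (cong +_ (catalan-evenIndex-%2 m)) (sym (aerate-odd catalanParity m))

[-n]%2≡n%2 : ∀ n → (- (+ n)) ℤ.% + 2 ≡ n ℕ.% 2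
[-n]%2≡n%2 zero = refl
[-n]%2≡n%2 (suc n) with suc n ℕ.% 2 | ND.m%n<n (suc n) 2
... | zero | _ = refl
... | suc zero | _ = refl
... | suc (suc r) | ℕ.s≤s (ℕ.s≤s ())

[±n]%2≡n%2 : ∀ m n → (sign m * + n) ℤ.% + 2 ≡ n ℕ.% 2
[±n]%2≡n%2 m n with sign-isUnit m
... | inj₁ sm≡1 rewrite sm≡1 = cong (ℤ._% + 2) (ℤP.*-identityˡ (+ n))
... | inj₂ sm≡-1 rewrite sm≡-1 = trans (cong (ℤ._% + 2) (ℤP.-1*i≡-i (+ n))) ([-n]%2≡n%2 n)

c%2≡aerate-catalanParity : ∀ n → + (c n ℤ.% + 2) ≡ aerate catalanParity n
c%2≡aerate-catalanParity n with parity n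
... | even m = trans (cong (λ x → + (x ℤ.% + 2)) (c-even m))
                     (trans (cong +_ ([±n]%2≡n%2 m (catalan m))) (sym (aerate-even catalanParity m)))
... | odd m = trans (cong (λ x → + (x ℤ.% + 2)) (c-odd m)) (sym (aerate-odd catalanParity m))

hankel : (ℕ → ℤ) → ∀ n → Matrix n
hankel a n i j = a (toℕ i ℕ.+ toℕ j)

det-hankel-cong : ∀ {a b : ℕ → ℤ} → (∀ m → a m ≡ b m) → ∀ n → det (hankel a n) ≡ det (hankel b n)
det-hankel-cong {a} {b} a≗b n = det-cong {A = hankel a n} {B = hankel b n} (λ i j → a≗b (toℕ i ℕ.+ toℕ j))

-- By counting, left and right together take each value 0, …, p + q - 1 exactly once.
record Interleaving (p q : ℕ) : Set where
  field
    left            : Fin p → ℕ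
    right           : Fin q → ℕ
    left-<          : ∀ i → left i ℕ.< p ℕ.+ q
    right-<         : ∀ j → right j ℕ.< p ℕ.+ q
    left-injective  : ∀ {i i′} → left i ≡ left i′ → i ≡ i′
    right-injective : ∀ {j j′} → right j ≡ right j′ → j ≡ j′
    left≢right      : ∀ i j → left i ≢ right j

  index : Fin p ⊎ Fin q → ℕ
  index = [ left , right ]

  index-< : ∀ x → index x ℕ.< p ℕ.+ q
  index-< = [ left-< , right-< ]

  index-injective : ∀ x y → index x ≡ index y → x ≡ y
  index-injective (inj₁ i) (inj₁ i′) eq = cong inj₁ (left-injective eq)
  index-injective (inj₁ i) (inj₂ j) eq = ⊥-elim (left≢right i j eq)
  index-injective (inj₂ j) (inj₁ i) eq = ⊥-elim (left≢right i j (sym eq))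
  index-injective (inj₂ j) (inj₂ j′) eq = cong inj₂ (right-injective eq)

  merge : Fin (p ℕ.+ q) → Fin (p ℕ.+ q)
  merge x = F.fromℕ< (index-< (F.splitAt p x))

  toℕ-merge : ∀ x → toℕ (merge x) ≡ index (F.splitAt p x)
  toℕ-merge x = FP.toℕ-fromℕ< (index-< (F.splitAt p x))

  toℕ-merge-↑ˡ : ∀ i → toℕ (merge (i ↑ˡ q)) ≡ left i
  toℕ-merge-↑ˡ i = trans (toℕ-merge (i ↑ˡ q)) (cong index (FP.splitAt-↑ˡ p i q))

  toℕ-merge-↑ʳ : ∀ j → toℕ (merge (p ↑ʳ j)) ≡ right j
  toℕ-merge-↑ʳ j = trans (toℕ-merge (p ↑ʳ j)) (cong index (FP.splitAt-↑ʳ p q j))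

  merge-injective : Injective _≡_ _≡_ merge
  merge-injective {x} {y} eq = begin
    x                           ≡⟨ FP.join-splitAt p q x ⟨
    F.join p q (F.splitAt p x)  ≡⟨ cong (F.join p q) (index-injective (F.splitAt p x) (F.splitAt p y) same-index) ⟩
    F.join p q (F.splitAt p y)  ≡⟨ FP.join-splitAt p q y ⟩
    y                           ∎
    where
    open ≡-Reasoning
    same-index = trans (sym (toℕ-merge x)) (trans (cong toℕ eq) (toℕ-merge y))

open Interleaving

det-hankel-interleave : ∀ {p q} (b : ℕ → ℤ) (rows cols : Interleaving p q) {t t′ : ℤ} →
  (∀ i j → b (left rows i ℕ.+ right cols j) ≡ + 0) →
  det (λ i j → b (left rows i ℕ.+ left cols j)) ≡ t →
  det (λ i j → b (right rows i ℕ.+ right cols j)) ≡ t′ →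
  det (hankel b (p ℕ.+ q)) ≡± t * t′
det-hankel-interleave {p} {q} b rows cols corner≡0 top-left bottom-right =
  ≡±-respʳ (det-permuteBlocks p q (hankel b (p ℕ.+ q)) (merge-injective rows) (merge-injective cols)
             (λ i j → trans (entry (toℕ-merge-↑ˡ rows i) (toℕ-merge-↑ʳ cols j)) (corner≡0 i j)))
    (cong₂ _*_ (trans (det-cong (λ i j → entry (toℕ-merge-↑ˡ rows i) (toℕ-merge-↑ˡ cols j))) top-left)
               (trans (det-cong (λ i j → entry (toℕ-merge-↑ʳ rows i) (toℕ-merge-↑ʳ cols j))) bottom-right))
  where
  entry : ∀ {x x′ y y′} → x ≡ x′ → y ≡ y′ → b (x ℕ.+ y) ≡ b (x′ ℕ.+ y′)
  entry = cong₂ (λ x y → b (x ℕ.+ y))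

double-injective : ∀ {m n} → m ℕ.+ m ≡ n ℕ.+ n → m ≡ n
double-injective {m} {n} eq = ℕP.*-cancelʳ-≡ m n 2 (trans (sym (m+m≡m*2 m)) (trans eq (m+m≡m*2 n)))

odd≢even : ∀ m n → suc (m ℕ.+ m) ≢ n ℕ.+ n
odd≢even m n eq with trans (sym ([1+m+m]%2≡1 m)) (trans (cong (ℕ._% 2) eq) ([m+m]%2≡0 n))
... | ()

even-< : ∀ {i p q} → i ℕ.< p → p ℕ.≤ suc q → i ℕ.+ i ℕ.< p ℕ.+ q
even-< i<p p≤q+1 = ℕP.+-mono-<-≤ i<p (ℕ.s≤s⁻¹ (ℕP.<-≤-trans i<p p≤q+1))

odd-< : ∀ {j p q} → j ℕ.< q → q ℕ.≤ p → suc (j ℕ.+ j) ℕ.< p ℕ.+ q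
odd-< {j} {p} {q} j<q q≤p =
  subst (ℕ._≤ p ℕ.+ q) (cong suc (ℕP.+-suc j j)) (ℕP.+-mono-≤ (ℕP.<-≤-trans j<q q≤p) j<q)

evens odds : ∀ {n} → Fin n → ℕ
evens i = toℕ i ℕ.+ toℕ i
odds i = suc (toℕ i ℕ.+ toℕ i)

evens-injective : ∀ {n} {i i′ : Fin n} → evens i ≡ evens i′ → i ≡ i′
evens-injective = FP.toℕ-injective ∘ double-injective

odds-injective : ∀ {n} {i i′ : Fin n} → odds i ≡ odds i′ → i ≡ i′
odds-injective = evens-injective ∘ ℕP.suc-injective

evens-odds : ∀ {p q} → q ℕ.≤ p → p ℕ.≤ suc q → Interleaving p q
evens-odds q≤p p≤q+1 = record
  { left = evens ; right = odds
  ; left-< = λ i → even-< (FP.toℕ<n i) p≤q+1 ; right-< = λ j → odd-< (FP.toℕ<n j) q≤p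
  ; left-injective = evens-injective ; right-injective = odds-injective
  ; left≢right = λ i j → odd≢even (toℕ j) (toℕ i) ∘ sym
  }

odds-evens : ∀ k → Interleaving k k
odds-evens k = record
  { left = odds ; right = evens
  ; left-< = λ i → odd-< (FP.toℕ<n i) ℕP.≤-refl ; right-< = λ j → even-< (FP.toℕ<n j) (ℕP.n≤1+n k)
  ; left-injective = odds-injective ; right-injective = evens-injective
  ; left≢right = λ i j → odd≢even (toℕ i) (toℕ j)
  }

zeroOdds-positiveEvens : ∀ k → Interleaving (suc k) k
zeroOdds-positiveEvens k = record
  { left = 0 ∷ odds ; right = λ j → suc (suc (evens j))
  ; left-< = λ { zero → ℕ.z<s ; (suc i) → odd-< (FP.toℕ<n i) (ℕP.n≤1+n k) }
  ; right-< = λ j → ℕ.s<s (odd-< (FP.toℕ<n j) ℕP.≤-refl)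
  ; left-injective = λ { {zero} {zero} _ → refl ; {zero} {suc _} () ; {suc _} {zero} ()
                       ; {suc i} {suc i′} eq → cong suc (odds-injective eq) }
  ; right-injective = evens-injective ∘ ℕP.suc-injective ∘ ℕP.suc-injective
  ; left≢right = λ { zero j () ; (suc i) j eq → odd≢even (toℕ j) (toℕ i) (sym (ℕP.suc-injective eq)) }
  }

even+even : ∀ x y → (x ℕ.+ x) ℕ.+ (y ℕ.+ y) ≡ (x ℕ.+ y) ℕ.+ (x ℕ.+ y)
even+even = ℕS.solve-∀

even+odd : ∀ x y → (x ℕ.+ x) ℕ.+ suc (y ℕ.+ y) ≡ suc ((x ℕ.+ y) ℕ.+ (x ℕ.+ y))
even+odd = ℕS.solve-∀

odd+odd : ∀ x y → suc (x ℕ.+ x) ℕ.+ suc (y ℕ.+ y) ≡ suc (suc ((x ℕ.+ y) ℕ.+ (x ℕ.+ y)))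
odd+odd = ℕS.solve-∀

det-hankel-aerate : ∀ a {p q} → q ℕ.≤ p → p ℕ.≤ suc q →
                    det (hankel (aerate a) (p ℕ.+ q)) ≡± det (hankel a p) * det (hankel (a ∘ suc) q)
det-hankel-aerate a {p} {q} q≤p p≤q+1 = det-hankel-interleave (aerate a) I I
  (λ i j → trans (cong (aerate a) (even+odd (toℕ i) (toℕ j))) (aerate-odd a (toℕ i ℕ.+ toℕ j)))
  (det-cong {B = hankel a p} (λ i j →
    trans (cong (aerate a) (even+even (toℕ i) (toℕ j))) (aerate-even a (toℕ i ℕ.+ toℕ j))))
  (det-cong {B = hankel (a ∘ suc) q} (λ i j →
    trans (cong (aerate a) (odd+odd (toℕ i) (toℕ j))) (aerate-even (a ∘ suc) (toℕ i ℕ.+ toℕ j))))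
  where
  I = evens-odds q≤p p≤q+1

module _ {a b : ℕ → ℤ} (b-suc : ∀ n → b (suc n) ≡ aerate a n) where

  det-hankel-shiftedAerate-even : ∀ k → det (hankel b (k ℕ.+ k)) ≡± det (hankel a k) * det (hankel a k)
  det-hankel-shiftedAerate-even k = det-hankel-interleave b (odds-evens k) (evens-odds ℕP.≤-refl (ℕP.n≤1+n k))
    (λ i j → trans (cong b (odd+odd (toℕ i) (toℕ j))) (trans (b-suc _) (aerate-odd a (toℕ i ℕ.+ toℕ j))))
    (det-cong {B = hankel a k} (λ i j → trans (b-suc _)
      (trans (cong (aerate a) (even+even (toℕ i) (toℕ j))) (aerate-even a (toℕ i ℕ.+ toℕ j)))))
    (det-cong {B = hankel a k} (λ i j → trans (cong b (even+odd (toℕ i) (toℕ j)))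
      (trans (b-suc _) (aerate-even a (toℕ i ℕ.+ toℕ j)))))

  det-hankel-shiftedAerate-odd : b 0 ≡ + 1 → ∀ k →
    det (hankel b (suc k ℕ.+ k)) ≡± det (hankel (a ∘ suc) k) * det (hankel (a ∘ suc) k)
  det-hankel-shiftedAerate-odd b0≡1 k =
    det-hankel-interleave b (evens-odds (ℕP.n≤1+n k) ℕP.≤-refl) (zeroOdds-positiveEvens k)
      (λ i j → trans (cong b (even+2+even (toℕ i) (toℕ j))) (trans (b-suc _) (aerate-odd a (toℕ i ℕ.+ toℕ j))))
      top-left
      (det-cong {B = hankel (a ∘ suc) k} (λ i j → trans (cong b (odd+2+even (toℕ i) (toℕ j)))
        (trans (b-suc _) (aerate-even a (suc (toℕ i ℕ.+ toℕ j))))))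
    where
    even+2+even : ∀ x y → (x ℕ.+ x) ℕ.+ suc (suc (y ℕ.+ y)) ≡ suc (suc ((x ℕ.+ y) ℕ.+ (x ℕ.+ y)))
    even+2+even = ℕS.solve-∀
    odd+2+even : ∀ x y → suc (x ℕ.+ x) ℕ.+ suc (suc (y ℕ.+ y)) ≡ suc (suc (x ℕ.+ y) ℕ.+ suc (x ℕ.+ y))
    odd+2+even = ℕS.solve-∀
    positiveEven+0 : ∀ x → (suc x ℕ.+ suc x) ℕ.+ 0 ≡ suc (suc (x ℕ.+ x))
    positiveEven+0 = ℕS.solve-∀
    positiveEven+odd : ∀ x y → (suc x ℕ.+ suc x) ℕ.+ suc (y ℕ.+ y) ≡ suc (suc (x ℕ.+ y) ℕ.+ suc (x ℕ.+ y))
    positiveEven+odd = ℕS.solve-∀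
    T : Matrix (suc k)
    T i j = b (evens i ℕ.+ (0 ∷ odds) j)
    top-left : det T ≡ det (hankel (a ∘ suc) k)
    top-left = begin
      det T
        ≡⟨ det-leftColumnZero T (λ i →
             trans (cong b (positiveEven+0 (toℕ i))) (trans (b-suc _) (aerate-odd a (toℕ i)))) ⟩
      b 0 * det (λ r c → T (suc r) (suc c))
        ≡⟨ cong₂ _*_ b0≡1 (det-cong {B = hankel (a ∘ suc) k} (λ r c →
             trans (cong b (positiveEven+odd (toℕ r) (toℕ c)))
                   (trans (b-suc _) (aerate-even a (suc (toℕ r ℕ.+ toℕ c)))))) ⟩
      + 1 * det (hankel (a ∘ suc) k)
        ≡⟨ ℤP.*-identityˡ _ ⟩
      det (hankel (a ∘ suc) k) ∎
      where open ≡-Reasoning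

det-hankel-catalanParity-isUnit : ∀ n →
  IsUnit (det (hankel catalanParity n)) × IsUnit (det (hankel (aerate catalanParity) n))
det-hankel-catalanParity-isUnit = <-rec Units step
  where
  e = catalanParity
  Units : ℕ → Set
  Units n = IsUnit (det (hankel e n)) × IsUnit (det (hankel (aerate e) n))
  shifted : ∀ k → IsUnit (det (hankel (aerate e) k)) → IsUnit (det (hankel (e ∘ suc) k))
  shifted k = subst IsUnit (sym (det-hankel-cong catalanParity-suc k))
  step : ∀ n → (∀ {m} → m ℕ.< n → Units m) → Units n
  step n rec with parity n
  ... | even zero = inj₁ refl , inj₁ refl
  ... | odd zero = inj₁ refl , inj₁ refl
  ... | even (suc k) with rec (ℕP.m<m+n (suc k) ℕ.z<s)
  ...   | e-unit , aerate-unit =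
          isUnit-≡±-* (det-hankel-shiftedAerate-even {e} {e} catalanParity-suc (suc k)) e-unit e-unit ,
          isUnit-≡±-* (det-hankel-aerate e ℕP.≤-refl (ℕP.n≤1+n (suc k))) e-unit (shifted (suc k) aerate-unit)
  step n rec | odd (suc k) with rec (ℕ.s<s (ℕP.m<m+n (suc k) ℕ.z<s)) | rec (ℕ.s<s (ℕP.m≤m+n (suc k) (suc k)))
  ...   | e-unit , _ | _ , aerate-unit =
          isUnit-≡±-* (det-hankel-shiftedAerate-odd {e} {e} catalanParity-suc refl (suc k)) e∘suc-unit e∘suc-unit ,
          isUnit-≡±-* (det-hankel-aerate e (ℕP.n≤1+n (suc k)) ℕP.≤-refl) e-unit e∘suc-unit
    where
    e∘suc-unit = shifted (suc k) aerate-unit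

det-H₂-isUnit : ∀ n → IsUnit (det (H₂ n))
det-H₂-isUnit n =
  subst IsUnit (sym (det-hankel-cong c%2≡aerate-catalanParity n)) (proj₂ (det-hankel-catalanParity-isUnit n))

theorem2 : (n : ℕ) → (det (H₁ n) ≡ + 1 ⊎ det (H₁ n) ≡ - + 1) × (det (H₂ n) ≡ + 1 ⊎ det (H₂ n) ≡ - + 1)
theorem2 n = det-H₁-isUnit n , det-H₂-isUnit n
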